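{- Let $\varepsilon\in(0,1/2)$. If $M$ is an $\varepsilon$-approximately maximal matching in a graph $G$, then during any sequence of at most $\varepsilon\mu(G)$ edge insertions and deletions applied to $G$, the edges of $M$ not yet deleted form a $6\varepsilon$-approximately maximal matching in the current graph.
   Context: $\mu(G)$ is the maximum matching size of $G$ (before the updates). A matching $M$ is an $\varepsilon'$-approximately maximal matching in a graph $H$ if it is inclusion-wise maximal in some subgraph obtained from $H$ by deleting at most $\varepsilon'\mu(H)$ vertices.
   Formalization: The parameter ε ranges over the rationals in $(0,1/2)$ rather than the reals. -}

module Defs where

open import Data.Nat using (ℕ; zero; suc)
open import Data.Bool using (Bool; true; false; _∨_; _∧_; not; if_then_else_)
open import Data.Fin using (Fin)
open import Data.Fin.Properties using (_≟_)
open import Data.Fin.Subset using (Subset; _∈_; _∉_; ∣_∣)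
open import Data.Product using (Σ; _×_; _,_; ∃)
open import Data.Sum using (_⊎_)
open import Data.List using (List; []; _∷_; length; concatMap; filterᵇ; foldl)
open import Data.List.Relation.Unary.All using (All)
open import Data.List.Relation.Unary.Unique.Propositional using (Unique)
open import Data.Integer using (+_)
open import Data.Rational using (ℚ; _/_; _≤_; _*_)
open import Relation.Binary.PropositionalEquality using (_≡_; _≢_)
open import Relation.Nullary.Decidable using (⌊_⌋)

toℚ : ℕ → ℚ
toℚ k = (+ k) / 1

Graph : ℕ → Set
Graph n = Fin n → Fin n → Bool

SimpleGraph : ∀ {n} → Graph n → Set
SimpleGraph {n} G = (∀ (u v : Fin n) → G u v ≡ G v u) × (∀ (u : Fin n) → G u u ≡ false)

Edge : ℕ → Set
Edge n = Fin n × Fin n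

samePair : ∀ {n} → Fin n → Fin n → Fin n → Fin n → Bool
samePair x y u v = (⌊ x ≟ u ⌋ ∧ ⌊ y ≟ v ⌋) ∨ (⌊ x ≟ v ⌋ ∧ ⌊ y ≟ u ⌋)

data Update (n : ℕ) : Set where
  ins : Fin n → Fin n → Update n
  del : Fin n → Fin n → Update n

ValidUpdate : ∀ {n} → Update n → Set
ValidUpdate (ins u v) = u ≢ v
ValidUpdate (del u v) = u ≢ v

apply : ∀ {n} → Graph n → Update n → Graph n
apply G (ins u v) x y = if samePair x y u v then true else G x y
apply G (del u v) x y = if samePair x y u v then false else G x y

applyAll : ∀ {n} → Graph n → List (Update n) → Graph n
applyAll G us = foldl apply G us

deletedBy : ∀ {n} → List (Update n) → Fin n → Fin n → Bool
deletedBy [] a b = false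
deletedBy (ins u v ∷ us) a b = deletedBy us a b
deletedBy (del u v ∷ us) a b = samePair a b u v ∨ deletedBy us a b

surviving : ∀ {n} → List (Edge n) → List (Update n) → List (Edge n)
surviving M us = filterᵇ (λ { (a , b) → not (deletedBy us a b) }) M

endpoints : ∀ {n} → List (Edge n) → List (Fin n)
endpoints = concatMap (λ { (u , v) → u ∷ v ∷ [] })

IsMatching : ∀ {n} → Graph n → List (Edge n) → Set
IsMatching H M = All (λ { (u , v) → H u v ≡ true }) M × Unique (endpoints M)

IsMaxMatchingSize : ∀ {n} → Graph n → ℕ → Set
IsMaxMatchingSize H k =
  (Σ (List (Edge _)) λ M → IsMatching H M × length M ≡ k) ×
  (∀ M → IsMatching H M → length M Data.Nat.≤ k)

deleteVertices : ∀ {n} → Graph n → Subset n → Graph n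
deleteVertices H S x y = H x y ∧ not ⌊ Data.Fin.Subset.Properties._∈?_ x S ⌋ ∧ not ⌊ Data.Fin.Subset.Properties._∈?_ y S ⌋
  where import Data.Fin.Subset.Properties

IsMaximalMatching : ∀ {n} → Graph n → List (Edge n) → Set
IsMaximalMatching {n} H M =
  IsMatching H M ×
  (∀ (u v : Fin n) → H u v ≡ true →
     Data.List.Membership.Propositional._∈_ u (endpoints M) ⊎ Data.List.Membership.Propositional._∈_ v (endpoints M))
  where import Data.List.Membership.Propositional

-- M is an ε'-approximately maximal matching in H, where μH = μ(H):
-- M is maximal in H − S for some vertex set S with |S| ≤ ε' μ(H)
IsApproxMaximal : ∀ {n} → ℚ → (H : Graph n) → (μH : ℕ) → List (Edge n) → Set
IsApproxMaximal {n} ε' H μH M =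
  Σ (Subset n) λ S → (toℚ ∣ S ∣ ≤ ε' * toℚ μH) × IsMaximalMatching (deleteVertices H S) M

module Submission where

-- Let S witness that M is maximal in G − S, and let k ≤ ε μ(G) be the number of updates.
-- Each update touches two vertices. Add to S the touched vertices that the surviving
-- matching M′ leaves unmatched; the result S′ has |S′| ≤ |S| + 2k, and M′ is maximal in
-- G′ − S′: an edge of G′ − S′ between two M′-unmatched vertices touches no updated vertex,
-- so it is an edge of G − S; then M matches one of its endpoints, whose M-edge must have
-- been deleted, making that endpoint touched after all.
-- For the size bound, a deletion destroys at most one edge of a maximum matching of G, so
-- μ(G) ≤ μ(G′) + k; as k ≤ ε μ(G) < μ(G)/2 this gives μ(G) ≤ 2 μ(G′), whence
-- |S′| ≤ 3 ε μ(G) ≤ 6 ε μ(G′).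

open import Defs
open import Data.Nat as ℕ using (ℕ; suc; _+_; z≤n; s≤s)
import Data.Nat.Properties as ℕ
open import Data.Integer as ℤ using (+_)
import Data.Integer.Properties as ℤ
open import Data.Rational using (ℚ; 0ℚ; 1ℚ; ½; _<_; _≤_; _*_; NonNegative; nonNegative; *≤*)
  renaming (_+_ to _+ℚ_)
open import Data.Rational.Literals using (fromℤ)
open import Data.Rational.Properties
  using (fromℚᵘ-toℚᵘ; drop-*≤*; toℚᵘ-injective; toℚᵘ-homo-+; +-mono-≤; *-distribʳ-+; *-identityˡ;
         module ≤-Reasoning; <⇒≤; ≤-trans; *-monoʳ-≤-nonNeg; *-monoˡ-≤-nonNeg)
import Data.Rational.Unnormalised as ℚᵘ
import Data.Rational.Unnormalised.Properties as ℚᵘ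
open import Data.Rational.Solver using (module +-*-Solver)
open import Data.Bool using (Bool; true; false)
open import Data.Bool.Properties using (T-not-≡; ∨-conicalˡ; ∨-conicalʳ)
open import Data.Fin using (Fin)
open import Data.Fin.Properties using (_≟_)
open import Data.Fin.Subset using (Subset; _∪_; ⁅_⁆; ∣_∣; inside; outside)
  renaming (_∈_ to _∈ₛ_; _∉_ to _∉ₛ_; ⊥ to ∅)
open import Data.Fin.Subset.Properties using (x∈p∪q⁻; x∈p∪q⁺; x∈⁅x⁆; x∈⁅y⁆⇒x≡y; ∉⊥; ∣⁅x⁆∣≡1; ∣⊥∣≡0)
  renaming (_∈?_ to _∈ₛ?_)
open import Data.Vec using ([]; _∷_)
open import Data.Product as Product using (Σ; _×_; _,_; proj₁; proj₂)
open import Data.Sum using (_⊎_; inj₁; inj₂)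
open import Data.Empty using (⊥-elim)
open import Data.List using (List; []; _∷_; length; map; filter; filterᵇ)
open import Data.List.Properties using (filter-all; length-filter; length-map)
open import Data.List.Relation.Unary.All as All using (All; []; _∷_)
open import Data.List.Relation.Unary.All.Properties using (anti-mono)
open import Data.List.Relation.Binary.Subset.Propositional using (_⊆_)
open import Data.List.Relation.Unary.AllPairs using (_∷_)
open import Data.List.Relation.Unary.Unique.Propositional using (Unique)
open import Data.List.Relation.Unary.Any using (here; there)
open import Data.List.Membership.Propositional using (_∈_; _∉_)
open import Data.List.Membership.Propositional.Properties using (∈-filter⁺; ∈-filter⁻)
open import Function using (_∘_; case_of_)
open import Function.Bundles using (Equivalence)
open import Relation.Binary.PropositionalEquality
open import Relation.Nullary using (yes; no)
open import Relation.Nullary.Decidable using (T?)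

∣p∪q∣≤∣p∣+∣q∣ : ∀ {n} (p q : Subset n) → ∣ p ∪ q ∣ ℕ.≤ ∣ p ∣ + ∣ q ∣
∣p∪q∣≤∣p∣+∣q∣ []            []            = z≤n
∣p∪q∣≤∣p∣+∣q∣ (inside ∷ p)  (inside ∷ q)  =
  s≤s (ℕ.≤-trans (∣p∪q∣≤∣p∣+∣q∣ p q) (ℕ.+-monoʳ-≤ ∣ p ∣ (ℕ.n≤1+n ∣ q ∣)))
∣p∪q∣≤∣p∣+∣q∣ (inside ∷ p)  (outside ∷ q) = s≤s (∣p∪q∣≤∣p∣+∣q∣ p q)
∣p∪q∣≤∣p∣+∣q∣ (outside ∷ p) (inside ∷ q)  =
  subst (suc ∣ p ∪ q ∣ ℕ.≤_) (sym (ℕ.+-suc ∣ p ∣ ∣ q ∣)) (s≤s (∣p∪q∣≤∣p∣+∣q∣ p q))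
∣p∪q∣≤∣p∣+∣q∣ (outside ∷ p) (outside ∷ q) = ∣p∪q∣≤∣p∣+∣q∣ p q

fromList : ∀ {n} → List (Fin n) → Subset n
fromList []       = ∅
fromList (x ∷ xs) = ⁅ x ⁆ ∪ fromList xs

∣fromList∣≤length : ∀ {n} (xs : List (Fin n)) → ∣ fromList xs ∣ ℕ.≤ length xs
∣fromList∣≤length {n} []       = ℕ.≤-reflexive (∣⊥∣≡0 n)
∣fromList∣≤length     (x ∷ xs) = ℕ.≤-trans (∣p∪q∣≤∣p∣+∣q∣ ⁅ x ⁆ (fromList xs))
  (subst (λ c → c + ∣ fromList xs ∣ ℕ.≤ suc (length xs)) (sym (∣⁅x⁆∣≡1 x)) (s≤s (∣fromList∣≤length xs)))

∈-fromList⁺ : ∀ {n} {x : Fin n} {xs} → x ∈ xs → x ∈ₛ fromList xs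
∈-fromList⁺ {x = x}      (here refl)  = x∈p∪q⁺ (inj₁ (x∈⁅x⁆ x))
∈-fromList⁺ {xs = y ∷ _} (there x∈xs) = x∈p∪q⁺ {p = ⁅ y ⁆} (inj₂ (∈-fromList⁺ x∈xs))

∈-fromList⁻ : ∀ {n} {x : Fin n} xs → x ∈ₛ fromList xs → x ∈ xs
∈-fromList⁻ []       x∈∅ = ⊥-elim (∉⊥ x∈∅)
∈-fromList⁻ (y ∷ xs) x∈  with x∈p∪q⁻ ⁅ y ⁆ (fromList xs) x∈
... | inj₁ x∈⁅y⁆ = here (x∈⁅y⁆⇒x≡y y x∈⁅y⁆)
... | inj₂ x∈xs  = there (∈-fromList⁻ xs x∈xs)

module _ {n : ℕ} where

  samePair-≢ : ∀ {x u v : Fin n} y → x ≢ u → x ≢ v → samePair x y u v ≡ false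
  samePair-≢ {x} {u} {v} y x≢u x≢v with x ≟ u | x ≟ v
  ... | yes x≡u | _       = ⊥-elim (x≢u x≡u)
  ... | no _    | yes x≡v = ⊥-elim (x≢v x≡v)
  ... | no _    | no _    = refl

  samePair-sound : ∀ (x y u v : Fin n) → samePair x y u v ≡ true → (x ≡ u × y ≡ v) ⊎ (x ≡ v × y ≡ u)
  samePair-sound x y u v eq with x ≟ u | y ≟ v | x ≟ v | y ≟ u
  ... | yes x≡u | yes y≡v | _       | _       = inj₁ (x≡u , y≡v)
  ... | yes _   | no _    | yes x≡v | yes y≡u = inj₂ (x≡v , y≡u)
  ... | no _    | _       | yes x≡v | yes y≡u = inj₂ (x≡v , y≡u)
  ... | yes _   | no _    | yes _   | no _    = case eq of λ ()
  ... | yes _   | no _    | no _    | _       = case eq of λ ()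
  ... | no _    | _       | yes _   | no _    = case eq of λ ()
  ... | no _    | _       | no _    | _       = case eq of λ ()

  ∈-endpoints : ∀ {L : List (Edge n)} {a b} → (a , b) ∈ L → a ∈ endpoints L × b ∈ endpoints L
  ∈-endpoints (here refl)  = here refl , there (here refl)
  ∈-endpoints (there ab∈L) = Product.map (there ∘ there) (there ∘ there) (∈-endpoints ab∈L)

  length-endpoints : ∀ (L : List (Edge n)) → length (endpoints L) ≡ length L + length L
  length-endpoints []      = refl
  length-endpoints (_ ∷ L) =
    cong suc (trans (cong suc (length-endpoints L)) (sym (ℕ.+-suc (length L) (length L))))

  endpoints-filter-⊆ : ∀ (p : Edge n → Bool) L → endpoints (filterᵇ p L) ⊆ endpoints L
  endpoints-filter-⊆ p []            ()
  endpoints-filter-⊆ p ((a , b) ∷ L) x∈ with p (a , b)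
  ... | false = there (there (endpoints-filter-⊆ p L x∈))
  ... | true with x∈
  ...   | here x≡a          = here x≡a
  ...   | there (here x≡b)  = there (here x≡b)
  ...   | there (there x∈L) = there (there (endpoints-filter-⊆ p L x∈L))

  unique-endpoints-filter : ∀ (p : Edge n → Bool) L → Unique (endpoints L) → Unique (endpoints (filterᵇ p L))
  unique-endpoints-filter p []            uniq = uniq
  unique-endpoints-filter p ((a , b) ∷ L) (a∉ ∷ b∉ ∷ uniq) with p (a , b)
  ... | false = unique-endpoints-filter p L uniq
  ... | true  = (All.head a∉ ∷ restrict (All.tail a∉)) ∷ restrict b∉ ∷ unique-endpoints-filter p L uniq
    where
    restrict : ∀ {P : Fin n → Set} → All P (endpoints L) → All P (endpoints (filterᵇ p L))
    restrict = anti-mono (endpoints-filter-⊆ p L)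

  updatedPair : Update n → Edge n
  updatedPair (ins u v) = u , v
  updatedPair (del u v) = u , v

  touched : List (Update n) → List (Fin n)
  touched us = endpoints (map updatedPair us)

  length-touched : ∀ us → length (touched us) ≡ length us + length us
  length-touched us =
    trans (length-endpoints (map updatedPair us))
          (cong₂ _+_ (length-map updatedPair us) (length-map updatedPair us))

  apply-untouched : ∀ (G : Graph n) w {x} y →
                    x ≢ proj₁ (updatedPair w) → x ≢ proj₂ (updatedPair w) → apply G w x y ≡ G x y
  apply-untouched G (ins u v) y x≢u x≢v rewrite samePair-≢ y x≢u x≢v = refl
  apply-untouched G (del u v) y x≢u x≢v rewrite samePair-≢ y x≢u x≢v = refl

  applyAll-untouched : ∀ (G : Graph n) us {x} y → x ∉ touched us → applyAll G us x y ≡ G x y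
  applyAll-untouched G []       y x∉ = refl
  applyAll-untouched G (w ∷ us) y x∉ =
    trans (applyAll-untouched (apply G w) us y (x∉ ∘ there ∘ there))
          (apply-untouched G w y (x∉ ∘ here) (x∉ ∘ there ∘ here))

  apply-ins-edge : ∀ (G : Graph n) u v {a b} → G a b ≡ true → apply G (ins u v) a b ≡ true
  apply-ins-edge G u v {a} {b} g with samePair a b u v
  ... | true  = refl
  ... | false = g

  apply-del-edge : ∀ (G : Graph n) u v {a b} → samePair a b u v ≡ false → G a b ≡ true →
                   apply G (del u v) a b ≡ true
  apply-del-edge G u v s g rewrite s = g

  applyAll-edge : ∀ (G : Graph n) us {a b} → deletedBy us a b ≡ false → G a b ≡ true → applyAll G us a b ≡ true
  applyAll-edge G []             d g = g
  applyAll-edge G (ins u v ∷ us) d g = applyAll-edge (apply G (ins u v)) us d (apply-ins-edge G u v g)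
  applyAll-edge G (del u v ∷ us) d g =
    applyAll-edge (apply G (del u v)) us (∨-conicalʳ _ _ d) (apply-del-edge G u v (∨-conicalˡ _ _ d) g)

  deleted⇒touched : ∀ us {a b} → deletedBy us a b ≡ true → a ∈ touched us × b ∈ touched us
  deleted⇒touched (ins u v ∷ us) d = Product.map (there ∘ there) (there ∘ there) (deleted⇒touched us d)
  deleted⇒touched (del u v ∷ us) {a} {b} d with samePair a b u v in s
  ... | true with samePair-sound a b u v s
  ...   | inj₁ (refl , refl) = here refl , there (here refl)
  ...   | inj₂ (refl , refl) = there (here refl) , here refl
  deleted⇒touched (del u v ∷ us) d | false = Product.map (there ∘ there) (there ∘ there) (deleted⇒touched us d)

  ∈-surviving⁻ : ∀ us {M : List (Edge n)} {a b} → (a , b) ∈ surviving M us →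
                 (a , b) ∈ M × deletedBy us a b ≡ false
  ∈-surviving⁻ us {M} ab∈ = Product.map₂ (Equivalence.to T-not-≡) (∈-filter⁻ _ {xs = M} ab∈)

  surviving-isMatching : ∀ {G : Graph n} us {M : List (Edge n)} → IsMatching G M →
                         IsMatching (applyAll G us) (surviving M us)
  surviving-isMatching {G} us {M} (edges , uniq) = All.tabulate edge , unique-endpoints-filter _ M uniq
    where
    edge : ∀ {e} → e ∈ surviving M us → applyAll G us (proj₁ e) (proj₂ e) ≡ true
    edge ab∈ = let ab∈M , kept = ∈-surviving⁻ us ab∈ in applyAll-edge G us kept (All.lookup edges ab∈M)

  lost⇒touched : ∀ us (M : List (Edge n)) {x} → x ∈ endpoints M → x ∉ endpoints (surviving M us) → x ∈ touched us
  lost⇒touched us ((a , b) ∷ M) x∈ x∉ with deletedBy us a b in d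
  lost⇒touched us ((a , b) ∷ M) (here refl)         x∉ | true  = proj₁ (deleted⇒touched us d)
  lost⇒touched us ((a , b) ∷ M) (there (here refl)) x∉ | true  = proj₂ (deleted⇒touched us d)
  lost⇒touched us ((a , b) ∷ M) (there (there x∈))  x∉ | true  = lost⇒touched us M x∈ x∉
  lost⇒touched us ((a , b) ∷ M) (here refl)         x∉ | false = ⊥-elim (x∉ (here refl))
  lost⇒touched us ((a , b) ∷ M) (there (here refl)) x∉ | false = ⊥-elim (x∉ (there (here refl)))
  lost⇒touched us ((a , b) ∷ M) (there (there x∈))  x∉ | false =
    lost⇒touched us M x∈ (λ x∈′ → x∉ (there (there x∈′)))

  surviving-[] : ∀ (M : List (Edge n)) → surviving M [] ≡ M
  surviving-[] M = filter-all (T? ∘ _) (All.universal _ M)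

  surviving-ins : ∀ us u v (M : List (Edge n)) → surviving M (ins u v ∷ us) ≡ surviving M us
  surviving-ins us u v []            = refl
  surviving-ins us u v ((a , b) ∷ M) with deletedBy us a b
  ... | true  = surviving-ins us u v M
  ... | false = cong ((a , b) ∷_) (surviving-ins us u v M)

  surviving-del-unpaired : ∀ us u v (M : List (Edge n)) → All (λ (c , e) → samePair c e u v ≡ false) M →
                           surviving M (del u v ∷ us) ≡ surviving M us
  surviving-del-unpaired us u v []            []       = refl
  surviving-del-unpaired us u v ((a , b) ∷ M) (s ∷ ss) rewrite s with deletedBy us a b
  ... | true  = surviving-del-unpaired us u v M ss
  ... | false = cong ((a , b) ∷_) (surviving-del-unpaired us u v M ss)

  disjoint⇒unpaired : ∀ {a b u v : Fin n} {M} → samePair a b u v ≡ true →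
                      All (a ≢_) (endpoints M) → All (b ≢_) (endpoints M) →
                      All (λ (c , e) → samePair c e u v ≡ false) M
  disjoint⇒unpaired {a} {b} {u} {v} {M} s a∉ b∉ =
    All.tabulate λ { {c , e} ce∈ → unpaired e (proj₁ (∈-endpoints ce∈)) }
    where
    unpaired : ∀ {c} e → c ∈ endpoints M → samePair c e u v ≡ false
    unpaired e c∈ with samePair-sound a b u v s
    ... | inj₁ (refl , refl) = samePair-≢ e (≢-sym (All.lookup a∉ c∈)) (≢-sym (All.lookup b∉ c∈))
    ... | inj₂ (refl , refl) = samePair-≢ e (≢-sym (All.lookup b∉ c∈)) (≢-sym (All.lookup a∉ c∈))

  -- The endpoints of a matching are distinct, so at most one of its edges is the deleted pair.
  length-surviving-∷ : ∀ us w (M : List (Edge n)) → Unique (endpoints M) →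
                       length (surviving M us) ℕ.≤ suc (length (surviving M (w ∷ us)))
  length-surviving-∷ us (ins u v) M _ =
    ℕ.≤-trans (ℕ.≤-reflexive (cong length (sym (surviving-ins us u v M)))) (ℕ.n≤1+n _)
  length-surviving-∷ us (del u v) []            _ = z≤n
  length-surviving-∷ us (del u v) ((a , b) ∷ M) (a∉ ∷ b∉ ∷ uniq)
    with deletedBy us a b | samePair a b u v in s
  ... | true  | true  = length-surviving-∷ us (del u v) M uniq
  ... | true  | false = length-surviving-∷ us (del u v) M uniq
  ... | false | false = s≤s (length-surviving-∷ us (del u v) M uniq)
  ... | false | true  = s≤s (ℕ.≤-reflexive (cong length (sym
                          (surviving-del-unpaired us u v M (disjoint⇒unpaired s (All.tail a∉) b∉)))))

  length-surviving : ∀ us (M : List (Edge n)) → Unique (endpoints M) →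
                     length M ℕ.≤ length (surviving M us) + length us
  length-surviving []       M _    = ℕ.≤-reflexive (sym (trans (ℕ.+-identityʳ _) (cong length (surviving-[] M))))
  length-surviving (w ∷ us) M uniq = begin
    length M                                        ≤⟨ length-surviving us M uniq ⟩
    length (surviving M us) + length us             ≤⟨ ℕ.+-monoˡ-≤ (length us) (length-surviving-∷ us w M uniq) ⟩
    suc (length (surviving M (w ∷ us))) + length us ≡⟨ ℕ.+-suc _ (length us) ⟨
    length (surviving M (w ∷ us)) + length (w ∷ us) ∎
    where open ℕ.≤-Reasoning

  matchingNumber-drop : ∀ {G : Graph n} us {μ μ′} → IsMaxMatchingSize G μ → IsMaxMatchingSize (applyAll G us) μ′ →
                        μ ℕ.≤ μ′ + length us
  matchingNumber-drop us ((M , isMatching , refl) , _) (_ , maximum) =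
    ℕ.≤-trans (length-surviving us M (proj₂ isMatching))
              (ℕ.+-monoˡ-≤ (length us) (maximum (surviving M us) (surviving-isMatching us isMatching)))

  deleteVertices-edge⁻ : ∀ (H : Graph n) S {a b} → deleteVertices H S a b ≡ true →
                         H a b ≡ true × a ∉ₛ S × b ∉ₛ S
  deleteVertices-edge⁻ H S {a} {b} e with H a b | a ∈ₛ? S | b ∈ₛ? S
  ... | true  | no a∉S | no b∉S = refl , a∉S , b∉S
  ... | true  | yes _  | _      = case e of λ ()
  ... | true  | no _   | yes _  = case e of λ ()
  ... | false | _      | _      = case e of λ ()

  deleteVertices-edge⁺ : ∀ (H : Graph n) S {a b} → H a b ≡ true → a ∉ₛ S → b ∉ₛ S →
                         deleteVertices H S a b ≡ true
  deleteVertices-edge⁺ H S {a} {b} e a∉S b∉S with H a b | a ∈ₛ? S | b ∈ₛ? S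
  ... | true  | no _    | no _    = refl
  ... | true  | yes a∈S | _       = ⊥-elim (a∉S a∈S)
  ... | true  | no _    | yes b∈S = ⊥-elim (b∉S b∈S)
  ... | false | _       | _       = case e of λ ()

module Repair {n} (G : Graph n) (S : Subset n) (M : List (Edge n)) (us : List (Update n)) where

  open import Data.List.Membership.DecPropositional (_≟_ {n}) using (_∈?_; _∉?_)

  G′ : Graph n
  G′ = applyAll G us

  M′ : List (Edge n)
  M′ = surviving M us

  freed : List (Fin n)
  freed = filter (_∉? endpoints M′) (touched us)

  S′ : Subset n
  S′ = S ∪ fromList freed

  ∣S′∣≤∣S∣+2k : ∣ S′ ∣ ℕ.≤ ∣ S ∣ + (length us + length us)
  ∣S′∣≤∣S∣+2k = ℕ.≤-trans (∣p∪q∣≤∣p∣+∣q∣ S (fromList freed)) (ℕ.+-monoʳ-≤ ∣ S ∣ (begin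
    ∣ fromList freed ∣    ≤⟨ ∣fromList∣≤length freed ⟩
    length freed          ≤⟨ length-filter (_∉? endpoints M′) (touched us) ⟩
    length (touched us)   ≡⟨ length-touched us ⟩
    length us + length us ∎))
    where open ℕ.≤-Reasoning

  ∉S⇒∉S′ : ∀ {x} → x ∉ₛ S → x ∈ endpoints M′ → x ∉ₛ S′
  ∉S⇒∉S′ x∉S x∈M′ x∈S′ with x∈p∪q⁻ S (fromList freed) x∈S′
  ... | inj₁ x∈S     = x∉S x∈S
  ... | inj₂ x∈freed =
    proj₂ (∈-filter⁻ (_∉? endpoints M′) {xs = touched us} (∈-fromList⁻ freed x∈freed)) x∈M′

  ∉S′⇒untouched : ∀ {x} → x ∉ₛ S′ → x ∉ endpoints M′ → x ∉ touched us
  ∉S′⇒untouched x∉S′ x∉M′ x∈touched =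
    x∉S′ (x∈p∪q⁺ (inj₂ (∈-fromList⁺ (∈-filter⁺ (_∉? endpoints M′) x∈touched x∉M′))))

  M′-isMatching : IsMatching (deleteVertices G S) M → IsMatching (deleteVertices G′ S′) M′
  M′-isMatching (edges , uniq) = All.tabulate edge , unique-endpoints-filter _ M uniq
    where
    edge : ∀ {e} → e ∈ M′ → deleteVertices G′ S′ (proj₁ e) (proj₂ e) ≡ true
    edge ab∈M′ with ∈-surviving⁻ us ab∈M′
    ... | ab∈M , kept with deleteVertices-edge⁻ G S (All.lookup edges ab∈M)
    ...   | g , a∉S , b∉S = let a∈M′ , b∈M′ = ∈-endpoints ab∈M′ in
      deleteVertices-edge⁺ G′ S′ (applyAll-edge G us kept g) (∉S⇒∉S′ a∉S a∈M′) (∉S⇒∉S′ b∉S b∈M′)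

  M′-maximal : IsMaximalMatching (deleteVertices G S) M → ∀ u v → deleteVertices G′ S′ u v ≡ true →
               u ∈ endpoints M′ ⊎ v ∈ endpoints M′
  M′-maximal (_ , maximal) u v e with deleteVertices-edge⁻ G′ S′ e | u ∈? endpoints M′ | v ∈? endpoints M′
  ... | _                | yes u∈M′ | _        = inj₁ u∈M′
  ... | _                | no _     | yes v∈M′ = inj₂ v∈M′
  ... | g′ , u∉S′ , v∉S′ | no u∉M′  | no v∉M′  = ⊥-elim (case maximal u v edge-of-G-S of λ
        { (inj₁ u∈M) → ∉S′⇒untouched u∉S′ u∉M′ (lost⇒touched us M u∈M u∉M′)
        ; (inj₂ v∈M) → ∉S′⇒untouched v∉S′ v∉M′ (lost⇒touched us M v∈M v∉M′) })
    where
    edge-of-G-S : deleteVertices G S u v ≡ true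
    edge-of-G-S =
      deleteVertices-edge⁺ G S (trans (sym (applyAll-untouched G us v (∉S′⇒untouched u∉S′ u∉M′))) g′)
        (λ u∈S → u∉S′ (x∈p∪q⁺ (inj₁ u∈S))) (λ v∈S → v∉S′ (x∈p∪q⁺ (inj₁ v∈S)))

maximal-after-updates : ∀ {n} (G : Graph n) S M us → IsMaximalMatching (deleteVertices G S) M →
                        Σ (Subset n) λ S′ → ∣ S′ ∣ ℕ.≤ ∣ S ∣ + (length us + length us) ×
                                            IsMaximalMatching (deleteVertices (applyAll G us) S′) (surviving M us)
maximal-after-updates G S M us maximal = S′ , ∣S′∣≤∣S∣+2k , M′-isMatching (proj₁ maximal) , M′-maximal maximal
  where open Repair G S M us

toℚ≡fromℤ : ∀ k → toℚ k ≡ fromℤ (+ k)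
toℚ≡fromℤ k = fromℚᵘ-toℚᵘ (fromℤ (+ k))

toℚ-mono-≤ : ∀ {k m} → k ℕ.≤ m → toℚ k ≤ toℚ m
toℚ-mono-≤ {k} {m} k≤m rewrite toℚ≡fromℤ k | toℚ≡fromℤ m =
  *≤* (ℤ.*-monoʳ-≤-nonNeg (+ 1) (ℤ.+≤+ k≤m))

toℚ-cancel-≤ : ∀ {k m} → toℚ k ≤ toℚ m → k ℕ.≤ m
toℚ-cancel-≤ {k} {m} k≤m rewrite toℚ≡fromℤ k | toℚ≡fromℤ m =
  ℤ.drop‿+≤+ (ℤ.*-cancelʳ-≤-pos (+ k) (+ m) (+ 1) (drop-*≤* k≤m))

toℚ-homo-+ : ∀ k m → toℚ (k + m) ≡ toℚ k +ℚ toℚ m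
toℚ-homo-+ k m rewrite toℚ≡fromℤ (k + m) | toℚ≡fromℤ k | toℚ≡fromℤ m =
  toℚᵘ-injective (ℚᵘ.≃-trans (ℚᵘ.*≡* cross-multiplied) (ℚᵘ.≃-sym (toℚᵘ-homo-+ (fromℤ (+ k)) (fromℤ (+ m)))))
  where
  open ≡-Reasoning
  cross-multiplied : + (k + m) ℤ.* + 1 ≡ (+ k ℤ.* + 1 ℤ.+ + m ℤ.* + 1) ℤ.* + 1
  cross-multiplied = begin
    + (k + m) ℤ.* + 1                     ≡⟨ ℤ.*-identityʳ _ ⟩
    + k ℤ.+ + m                           ≡⟨ cong₂ ℤ._+_ (ℤ.*-identityʳ (+ k)) (ℤ.*-identityʳ (+ m)) ⟨
    + k ℤ.* + 1 ℤ.+ + m ℤ.* + 1           ≡⟨ ℤ.*-identityʳ _ ⟨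
    (+ k ℤ.* + 1 ℤ.+ + m ℤ.* + 1) ℤ.* + 1 ∎

toℚ-nonNeg : ∀ k → NonNegative (toℚ k)
toℚ-nonNeg k = nonNegative (toℚ-mono-≤ {0} {k} z≤n)

toℚm≤½toℚn⇒m+m≤n : ∀ m n → toℚ m ≤ ½ * toℚ n → m + m ℕ.≤ n
toℚm≤½toℚn⇒m+m≤n m n m≤n/2 = toℚ-cancel-≤ (begin
  toℚ (m + m)             ≡⟨ toℚ-homo-+ m m ⟩
  toℚ m +ℚ toℚ m          ≤⟨ +-mono-≤ m≤n/2 m≤n/2 ⟩
  ½ * toℚ n +ℚ ½ * toℚ n  ≡⟨ *-distribʳ-+ (toℚ n) ½ ½ ⟨
  1ℚ * toℚ n              ≡⟨ *-identityˡ (toℚ n) ⟩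
  toℚ n                   ∎)
  where open ≤-Reasoning

m+m≤n⇒n≤o+m⇒n≤o+o : ∀ m {n o} → m + m ℕ.≤ n → n ℕ.≤ o + m → n ℕ.≤ o + o
m+m≤n⇒n≤o+m⇒n≤o+o m {o = o} m+m≤n n≤o+m =
  ℕ.≤-trans n≤o+m (ℕ.+-monoʳ-≤ o (ℕ.+-cancelʳ-≤ m m o (ℕ.≤-trans m+m≤n n≤o+m)))

approximation-bound : ∀ {ε} s k μ {s′ μ′} → 0ℚ < ε → ε < ½ →
                      toℚ s ≤ ε * toℚ μ → toℚ k ≤ ε * toℚ μ →
                      s′ ℕ.≤ s + (k + k) → μ ℕ.≤ μ′ + k →
                      toℚ s′ ≤ toℚ 6 * ε * toℚ μ′
approximation-bound {ε} s k μ {s′} {μ′} 0<ε ε<½ s≤εμ k≤εμ s′≤s+2k μ≤μ′+k = begin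
  toℚ s′                                        ≤⟨ toℚ-mono-≤ s′≤s+2k ⟩
  toℚ (s + (k + k))                             ≡⟨ toℚ-homo-+ s (k + k) ⟩
  toℚ s +ℚ toℚ (k + k)                          ≡⟨ cong (toℚ s +ℚ_) (toℚ-homo-+ k k) ⟩
  toℚ s +ℚ (toℚ k +ℚ toℚ k)                     ≤⟨ +-mono-≤ s≤εμ (+-mono-≤ k≤εμ k≤εμ) ⟩
  εμ +ℚ (εμ +ℚ εμ)                              ≤⟨ +-mono-≤ εμ≤2εμ′ (+-mono-≤ εμ≤2εμ′ εμ≤2εμ′) ⟩
  2εμ′ +ℚ (2εμ′ +ℚ 2εμ′)                        ≡⟨ six-fold ε (toℚ μ′) ⟩
  toℚ 6 * ε * toℚ μ′                            ∎
  where
  open ≤-Reasoning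
  instance
    ε-nonNeg : NonNegative ε
    ε-nonNeg = nonNegative (<⇒≤ 0<ε)
    μ-nonNeg : NonNegative (toℚ μ)
    μ-nonNeg = toℚ-nonNeg μ
  εμ 2εμ′ : ℚ
  εμ = ε * toℚ μ
  2εμ′ = ε * (toℚ μ′ +ℚ toℚ μ′)
  k≤½μ : toℚ k ≤ ½ * toℚ μ
  k≤½μ = ≤-trans k≤εμ (*-monoʳ-≤-nonNeg (toℚ μ) (<⇒≤ ε<½))
  μ≤2μ′ : μ ℕ.≤ μ′ + μ′
  μ≤2μ′ = m+m≤n⇒n≤o+m⇒n≤o+o k (toℚm≤½toℚn⇒m+m≤n k μ k≤½μ) μ≤μ′+k
  εμ≤2εμ′ : εμ ≤ 2εμ′
  εμ≤2εμ′ = *-monoˡ-≤-nonNeg ε (subst (toℚ μ ≤_) (toℚ-homo-+ μ′ μ′) (toℚ-mono-≤ μ≤2μ′))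
  six-fold : ∀ e m → e * (m +ℚ m) +ℚ (e * (m +ℚ m) +ℚ e * (m +ℚ m)) ≡ toℚ 6 * e * m
  six-fold = solve 2 (λ e m → e :* (m :+ m) :+ (e :* (m :+ m) :+ e :* (m :+ m)) := con (toℚ 6) :* e :* m) refl
    where open +-*-Solver

lemma5p8 : ∀ {n : ℕ} (ε : ℚ) → 0ℚ < ε → ε < ½ →
           (G : Graph n) → SimpleGraph G →
           (μG : ℕ) → IsMaxMatchingSize G μG →
           (M : List (Edge n)) → IsApproxMaximal ε G μG M →
           (us : List (Update n)) → All ValidUpdate us →
           toℚ (length us) ≤ ε * toℚ μG →
           (μ' : ℕ) → IsMaxMatchingSize (applyAll G us) μ' →
           IsApproxMaximal (toℚ 6 * ε) (applyAll G us) μ' (surviving M us)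
lemma5p8 ε 0<ε ε<½ G _ μG μG-max M (S , ∣S∣≤εμG , maximal) us _ k≤εμG μ′ μ′-max
  with maximal-after-updates G S M us maximal
... | S′ , ∣S′∣≤∣S∣+2k , maximal′ =
  S′ ,
  approximation-bound ∣ S ∣ (length us) μG 0<ε ε<½ ∣S∣≤εμG k≤εμG
    ∣S′∣≤∣S∣+2k (matchingNumber-drop us μG-max μ′-max) ,
  maximal′
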